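{- Let $G$ be a graph on $n$ vertices and let $q$ be a positive integer. If $G$ is a $q$-OR-PCG, then $G$ is an $(n,t)$-threshold-PCG for every integer $t$ with $1\le t\le n-q+1$.
   Context: All graphs are finite, simple and undirected. For an edge-weighted tree $T$ (nonnegative real edge weights) and leaves $x,y$, $d_T(x,y)$ is the sum of the weights on the unique $x$–$y$ path; $L(T)$ is the leaf set. A graph $G=(V,E)$ is a PCG (pairwise compatibility graph) if there exist an edge-weighted tree $T$, reals $0\le d_{\min}\le d_{\max}$ and a bijection $\zeta:V\to L(T)$ such that for all distinct $u,v\in V$: $uv\in E \iff d_{\min}\le d_T(\zeta(u),\zeta(v))\le d_{\max}$. A graph $G=(V,E)$ is a $q$-OR-PCG if there exist PCGs $G_1=(V,E_1),\dots,G_q=(V,E_q)$ on the same vertex set with $E=E_1\cup\cdots\cup E_q$. For integers $1\le t\le k$, $G=(V,E)$ is a $(k,t)$-threshold-PCG if there exist PCGs $G_1=(V,E_1),\dots,G_k=(V,E_k)$ on the same vertex set such that for all distinct $u,v\in V$: $uv\in E \iff |\{i\in\{1,\dots,k\}: uv\in E_i\}|\ge t$.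
   Formalization: The edge weights of the trees and the bounds $d_{\min}$, $d_{\max}$ in the definition of a PCG are rational instead of real. -}

module Defs where

open import Data.Nat using (ℕ; _≤_; _+_)
open import Data.Bool using (Bool; true; false; if_then_else_)
open import Data.Fin using (Fin)
open import Data.List using (List; []; _∷_; map; allFin)
open import Data.Nat.ListAction using (sum)
open import Data.List.Relation.Unary.Unique.Propositional using (Unique)
open import Data.Rational as ℚ using (ℚ; 0ℚ)
open import Data.Product using (Σ; ∃; _×_; proj₁)
open import Relation.Binary.PropositionalEquality using (_≡_; _≢_)
open import Function.Bundles using (_⇔_)
open import Function.Definitions using (Injective)

record Graph (n : ℕ) : Set where
  field
    adj    : Fin n → Fin n → Bool
    sym    : ∀ u v → adj u v ≡ adj v u
    irrefl : ∀ v → adj v v ≡ false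
open Graph public

count : ∀ {k} → (Fin k → Bool) → ℕ
count {k} b = sum (map (λ i → if b i then 1 else 0) (allFin k))

data Walk {m : ℕ} (A : Fin m → Fin m → Bool) : Fin m → Fin m → Set where
  stop : ∀ x → Walk A x x
  step : ∀ {x y z} → A x y ≡ true → Walk A y z → Walk A x z

verts : ∀ {m} {A : Fin m → Fin m → Bool} {x y} → Walk A x y → List (Fin m)
verts (stop x) = x ∷ []
verts (step {x = x} _ p) = x ∷ verts p

walkWeight : ∀ {m} {A : Fin m → Fin m → Bool} → (Fin m → Fin m → ℚ) →
             ∀ {x y} → Walk A x y → ℚ
walkWeight w (stop x) = 0ℚ
walkWeight w (step {x = x} {y = y} _ p) = w x y ℚ.+ walkWeight w p

IsPath : ∀ {m} {A : Fin m → Fin m → Bool} {x y} → Walk A x y → Set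
IsPath p = Unique (verts p)

record WTree : Set where
  field
    m         : ℕ
    nonempty  : 1 ≤ m
    graph     : Graph m
    w         : Fin m → Fin m → ℚ
    w-nonneg  : ∀ x y → 0ℚ ℚ.≤ w x y
    w-sym     : ∀ x y → w x y ≡ w y x
    connected : ∀ x y → Σ (Walk (adj graph) x y) IsPath
    uniquePath : ∀ x y (p q : Walk (adj graph) x y) → IsPath p → IsPath q →
                 verts p ≡ verts q
open WTree public

degree : (T : WTree) → Fin (m T) → ℕ
degree T x = count (adj (graph T) x)

IsLeaf : (T : WTree) → Fin (m T) → Set
IsLeaf T x = degree T x ≡ 1

dist : (T : WTree) → Fin (m T) → Fin (m T) → ℚ
dist T x y = walkWeight (w T) (proj₁ (connected T x y))

record IsPCG {n : ℕ} (G : Graph n) : Set where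
  field
    T        : WTree
    dmin     : ℚ
    dmax     : ℚ
    dmin-nonneg : 0ℚ ℚ.≤ dmin
    dmin≤dmax   : dmin ℚ.≤ dmax
    ζ        : Fin n → Fin (m T)
    ζ-inj    : Injective _≡_ _≡_ ζ
    ζ-leaf   : ∀ v → IsLeaf T (ζ v)
    ζ-onto   : ∀ x → IsLeaf T x → ∃ λ v → ζ v ≡ x
    compat   : ∀ u v → u ≢ v →
               (adj G u v ≡ true) ⇔ (dmin ℚ.≤ dist T (ζ u) (ζ v) × dist T (ζ u) (ζ v) ℚ.≤ dmax)

IsORPCG : (q : ℕ) → ∀ {n} → Graph n → Set
IsORPCG q {n} G =
  Σ (Fin q → Graph n) λ Gs →
    (∀ i → IsPCG (Gs i)) ×
    (∀ u v → u ≢ v → (adj G u v ≡ true) ⇔ (∃ λ i → adj (Gs i) u v ≡ true))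

IsThresholdPCG : (k t : ℕ) → ∀ {n} → Graph n → Set
IsThresholdPCG k t {n} G =
  1 ≤ t × t ≤ k ×
  Σ (Fin k → Graph n) λ Gs →
    (∀ i → IsPCG (Gs i)) ×
    (∀ u v → u ≢ v → (adj G u v ≡ true) ⇔ (t ≤ count (λ i → adj (Gs i) u v)))

-- Pad the q PCGs of an OR-decomposition with t − 1 copies of the complete graph and
-- n − q − t + 1 copies of the edgeless graph.  Both are PCGs on the tree of any one of
-- the q PCGs: cut its leaf distances by the window [0, M], resp. [M + 1, M + 1], where
-- M bounds all leaf distances.  An edge then lies in at least t of the n graphs iff it
-- lies in at least one of the q original ones.
module Submission where

open import Defs
open import Data.Nat using (ℕ; suc; _+_; _≤_; _<_; s≤s; s≤s⁻¹; z≤n)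
open import Data.Nat.Properties
  using (+-assoc; +-identityʳ; +-comm; +-cancelˡ-<; m<m+n; m≤m+n; m≤n+m; ≤-trans; m≤n⇒∃[o]m+o≡n)
open import Data.Bool using (Bool; true; false; if_then_else_; not)
open import Data.Fin using (Fin; zero; suc; _≟_; splitAt)
import Data.List as List
open import Data.List.Properties using (map-tabulate; map-cong)
open import Data.List.Relation.Unary.All.Properties using (tabulate⁻)
open import Data.Nat.ListAction using (sum)
import Data.Rational as ℚ
open ℚ using (ℚ; 0ℚ; 1ℚ)
import Data.Rational.Properties as ℚₚ
open import Relation.Binary.Bundles using (DecTotalOrder)
open import Data.List.Extrema (DecTotalOrder.totalOrder ℚₚ.≤-decTotalOrder) using (max; ⊥≤max; xs≤max)
open import Data.Vec.Functional using (Vector; map; replicate; tail; _++_)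
open import Data.Vec.Functional.Relation.Unary.All using (All)
open import Data.Vec.Functional.Relation.Unary.All.Properties using (++⁺)
open import Data.Vec.Functional.Relation.Unary.Any using (Any)
open import Data.Product using (_×_; _,_; proj₁)
open import Data.Empty using (⊥-elim)
open import Data.Sum.Properties using ([,]-map)
open import Relation.Nullary using (does; yes; no)
open import Relation.Nullary.Decidable using (dec-true; dec-false)
import Relation.Binary.PropositionalEquality as ≡
open ≡ using (_≡_; _≢_; refl; trans; cong; cong₂; subst; _≗_; module ≡-Reasoning)
open import Function using (_∘_; id; _⇔_; mk⇔)
import Function.Properties.Equivalence as ⇔

open ≡-Reasoning

count-suc : ∀ {k} (b : Vector Bool (suc k)) →
            count b ≡ (if b zero then 1 else 0) + count (tail b)
count-suc {k} b = cong (λ xs → χ zero + sum xs) (begin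
  List.map χ (List.tabulate suc)        ≡⟨ map-tabulate suc χ ⟩
  List.tabulate (χ ∘ suc)               ≡⟨ map-tabulate id (χ ∘ suc) ⟨
  List.map (χ ∘ suc) (List.allFin k)    ∎)
  where
  χ : Fin (suc k) → ℕ
  χ i = if b i then 1 else 0

count-cong : ∀ {k} {b c : Vector Bool k} → b ≗ c → count b ≡ count c
count-cong {k} b≗c = cong sum (map-cong (λ i → cong (λ x → if x then 1 else 0) (b≗c i)) (List.allFin k))

count-map-++ : ∀ {A : Set} {m n} (f : A → Bool) (xs : Vector A m) (ys : Vector A n) →
               count (map f (xs ++ ys)) ≡ count (map f xs) + count (map f ys)
count-map-++ {m = 0}     f xs ys = refl
count-map-++ {m = suc m} f xs ys = begin
  count (map f (xs ++ ys))                              ≡⟨ count-suc (map f (xs ++ ys)) ⟩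
  χ + count (tail (map f (xs ++ ys)))                   ≡⟨ cong (χ +_) (count-cong (cong f ∘ [,]-map ∘ splitAt m)) ⟩
  χ + count (map f (tail xs ++ ys))                     ≡⟨ cong (χ +_) (count-map-++ f (tail xs) ys) ⟩
  χ + (count (map f (tail xs)) + count (map f ys))      ≡⟨ +-assoc χ _ _ ⟨
  χ + count (map f (tail xs)) + count (map f ys)        ≡⟨ cong (_+ count (map f ys)) (count-suc (map f xs)) ⟨
  count (map f xs) + count (map f ys)                   ∎
  where
  χ : ℕ
  χ = if f (xs zero) then 1 else 0

count-replicate-true : ∀ k → count (replicate k true) ≡ k
count-replicate-true 0       = refl
count-replicate-true (suc k) = trans (count-suc (replicate (suc k) true)) (cong suc (count-replicate-true k))

count-replicate-false : ∀ k → count (replicate k false) ≡ 0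
count-replicate-false 0       = refl
count-replicate-false (suc k) = trans (count-suc (replicate (suc k) false)) (count-replicate-false k)

count-pos⇒Any : ∀ {k} (b : Vector Bool k) → 0 < count b → Any (_≡ true) b
count-pos⇒Any {0}     b ()
count-pos⇒Any {suc k} b 0<count with b zero in b₀ | subst (0 <_) (count-suc b) 0<count
... | true  | _           = zero , b₀
... | false | 0<count-tail with count-pos⇒Any (tail b) 0<count-tail
...   | i , bᵢ = suc i , bᵢ

Any⇒count-pos : ∀ {k} (b : Vector Bool k) → Any (_≡ true) b → 0 < count b
Any⇒count-pos b (zero , b₀) rewrite count-suc b | b₀ = s≤s z≤n
Any⇒count-pos b (suc i , bᵢ) rewrite count-suc b =
  ≤-trans (Any⇒count-pos (tail b) (i , bᵢ)) (m≤n+m _ _)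

0<count⇔Any : ∀ {k} (b : Vector Bool k) → 0 < count b ⇔ Any (_≡ true) b
0<count⇔Any b = mk⇔ (count-pos⇒Any b) (Any⇒count-pos b)

m<m+n⇔0<n : ∀ m {n} → m < m + n ⇔ 0 < n
m<m+n⇔0<n m {n} = mk⇔ (+-cancelˡ-< m 0 n ∘ subst (_< m + n) (≡.sym (+-identityʳ m))) (m<m+n m)

walkWeight-nonneg : ∀ {k} {A : Fin k → Fin k → Bool} {w : Fin k → Fin k → ℚ} →
                    (∀ x y → 0ℚ ℚ.≤ w x y) → ∀ {x y} (p : Walk A x y) → 0ℚ ℚ.≤ walkWeight w p
walkWeight-nonneg w≥0 (stop _) = ℚₚ.≤-refl
walkWeight-nonneg w≥0 (step {x = x} {y = y} _ p) = ℚₚ.+-mono-≤ (w≥0 x y) (walkWeight-nonneg w≥0 p)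

dist-nonneg : ∀ T x y → 0ℚ ℚ.≤ dist T x y
dist-nonneg T x y = walkWeight-nonneg (w-nonneg T) (proj₁ (connected T x y))

maxOf : ∀ {k} → (Fin k → ℚ) → ℚ
maxOf f = max 0ℚ (List.tabulate f)

≤-maxOf : ∀ {k} (f : Fin k → ℚ) i → f i ℚ.≤ maxOf f
≤-maxOf f = tabulate⁻ (xs≤max 0ℚ (List.tabulate f))

0≤maxOf : ∀ {k} (f : Fin k → ℚ) → 0ℚ ℚ.≤ maxOf f
0≤maxOf f = ⊥≤max 0ℚ (List.tabulate f)

complete : ∀ n → Graph n
complete n = record
  { adj    = λ u v → not (does (u ≟ v))
  ; sym    = λ u v → cong not (does-≟-sym u v)
  ; irrefl = λ v → cong not (dec-true (v ≟ v) refl)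
  }
  where
  does-≟-sym : ∀ u v → does (u ≟ v) ≡ does (v ≟ u)
  does-≟-sym u v with u ≟ v
  ... | yes u≡v = ≡.sym (dec-true (v ≟ u) (≡.sym u≡v))
  ... | no  u≢v = ≡.sym (dec-false (v ≟ u) (u≢v ∘ ≡.sym))

complete-adj : ∀ {n} {u v : Fin n} → u ≢ v → adj (complete n) u v ≡ true
complete-adj {u = u} {v} u≢v = cong not (dec-false (u ≟ v) u≢v)

edgeless : ∀ n → Graph n
edgeless n = record { adj = λ _ _ → false ; sym = λ _ _ → refl ; irrefl = λ _ → refl }

module _ {n} {H : Graph n} (P : IsPCG H) where
  open IsPCG P

  leafDist : Fin n → Fin n → ℚ
  leafDist u v = dist T (ζ u) (ζ v)

  isPCG-onSameTree : (K : Graph n) {a b : ℚ} → 0ℚ ℚ.≤ a → a ℚ.≤ b →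
    (∀ u v → u ≢ v → (adj K u v ≡ true) ⇔ (a ℚ.≤ leafDist u v × leafDist u v ℚ.≤ b)) →
    IsPCG K
  isPCG-onSameTree K {a} {b} 0≤a a≤b K⇔window = record
    { T = T ; dmin = a ; dmax = b ; dmin-nonneg = 0≤a ; dmin≤dmax = a≤b
    ; ζ = ζ ; ζ-inj = ζ-inj ; ζ-leaf = ζ-leaf ; ζ-onto = ζ-onto ; compat = K⇔window }

  maxLeafDist : ℚ
  maxLeafDist = maxOf (λ u → maxOf (leafDist u))

  leafDist≤maxLeafDist : ∀ u v → leafDist u v ℚ.≤ maxLeafDist
  leafDist≤maxLeafDist u v = ℚₚ.≤-trans (≤-maxOf (leafDist u) v) (≤-maxOf (λ u → maxOf (leafDist u)) u)

  0≤maxLeafDist : 0ℚ ℚ.≤ maxLeafDist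
  0≤maxLeafDist = 0≤maxOf (λ u → maxOf (leafDist u))

  complete-isPCG : IsPCG (complete n)
  complete-isPCG = isPCG-onSameTree (complete n) ℚₚ.≤-refl 0≤maxLeafDist λ u v u≢v →
    mk⇔ (λ _ → dist-nonneg T (ζ u) (ζ v) , leafDist≤maxLeafDist u v) (λ _ → complete-adj u≢v)

  edgeless-isPCG : IsPCG (edgeless n)
  edgeless-isPCG = isPCG-onSameTree (edgeless n) 0≤M+1 ℚₚ.≤-refl λ u v _ →
    mk⇔ (λ ()) (λ (M+1≤d , _) → ⊥-elim (ℚₚ.<-irrefl refl
      (ℚₚ.≤-<-trans (ℚₚ.≤-trans M+1≤d (leafDist≤maxLeafDist u v)) M<M+1)))
    where
    M<M+1 : maxLeafDist ℚ.< maxLeafDist ℚ.+ 1ℚ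
    M<M+1 = subst (ℚ._< maxLeafDist ℚ.+ 1ℚ) (ℚₚ.+-identityʳ maxLeafDist)
              (ℚₚ.+-monoʳ-< maxLeafDist (ℚₚ.positive⁻¹ 1ℚ))
    0≤M+1 : 0ℚ ℚ.≤ maxLeafDist ℚ.+ 1ℚ
    0≤M+1 = ℚₚ.≤-trans 0≤maxLeafDist (ℚₚ.<⇒≤ M<M+1)

isORPCG⇒isThresholdPCG : ∀ a q r (G : Graph (a + suc q + r)) →
                         IsORPCG (suc q) G → IsThresholdPCG (a + suc q + r) (suc a) G
isORPCG⇒isThresholdPCG a q r G (Hs , Hs-pcg , G⇔OR) =
  s≤s z≤n , ≤-trans (m<m+n a (s≤s z≤n)) (m≤m+n _ r) , Gs , Gs-pcg , G⇔threshold
  where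
  Ks : Vector (Graph _) a
  Ks = replicate a (complete _)

  Es : Vector (Graph _) r
  Es = replicate r (edgeless _)

  Gs : Vector (Graph _) (a + suc q + r)
  Gs = (Ks ++ Hs) ++ Es

  Ks-pcg : All IsPCG Ks
  Ks-pcg _ = complete-isPCG (Hs-pcg zero)

  Es-pcg : All IsPCG Es
  Es-pcg _ = edgeless-isPCG (Hs-pcg zero)

  Gs-pcg : All IsPCG Gs
  Gs-pcg = ++⁺ IsPCG (++⁺ IsPCG Ks-pcg Hs-pcg) Es-pcg

  G⇔threshold : ∀ u v → u ≢ v → (adj G u v ≡ true) ⇔ (a < count (λ i → adj (Gs i) u v))
  G⇔threshold u v u≢v = subst (λ c → (adj G u v ≡ true) ⇔ (a < c)) (≡.sym count-Gs)
    (⇔.trans (G⇔OR u v u≢v) (⇔.trans (⇔.sym (0<count⇔Any (map uv∈ Hs))) (⇔.sym (m<m+n⇔0<n a))))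
    where
    uv∈ : Graph _ → Bool
    uv∈ K = adj K u v

    count-Gs : count (map uv∈ Gs) ≡ a + count (map uv∈ Hs)
    count-Gs = begin
      count (map uv∈ Gs)
        ≡⟨ count-map-++ uv∈ (Ks ++ Hs) Es ⟩
      count (map uv∈ (Ks ++ Hs)) + count (replicate r false)
        ≡⟨ cong₂ _+_ (count-map-++ uv∈ Ks Hs) (count-replicate-false r) ⟩
      count (replicate a (uv∈ (complete _))) + count (map uv∈ Hs) + 0
        ≡⟨ +-identityʳ _ ⟩
      count (replicate a (uv∈ (complete _))) + count (map uv∈ Hs)
        ≡⟨ cong (λ x → count (replicate a x) + count (map uv∈ Hs)) (complete-adj u≢v) ⟩
      count (replicate a true) + count (map uv∈ Hs)
        ≡⟨ cong (_+ count (map uv∈ Hs)) (count-replicate-true a) ⟩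
      a + count (map uv∈ Hs)
        ∎

lemma7 : (n q : ℕ) → (G : Graph n) → 1 ≤ q → IsORPCG q G →
         (t : ℕ) → 1 ≤ t → t + q ≤ n + 1 → IsThresholdPCG n t G
lemma7 n (suc q) G _ G-or (suc a) _ t+q≤n+1
  with m≤n⇒∃[o]m+o≡n (s≤s⁻¹ (subst (suc a + suc q ≤_) (+-comm n 1) t+q≤n+1))
... | r , refl = isORPCG⇒isThresholdPCG a q r G G-or
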